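{- Let $\varepsilon\in(0,2)$. Let $G$ be a connected graph with minimum degree $3$ and average degree at least $4+\varepsilon$, 2-cell embedded in a surface with Euler genus $g$, such that $|G|\geq(\frac{24}{\varepsilon}+6)g$. Then $G$ has a vertex $v$ that sees at most $2+\lceil 12/\varepsilon\rceil$ other vertices.
   Context: Graphs are finite and simple; $|G|$ is the number of vertices; the average degree is $2|E(G)|/|V(G)|$. The Euler genus of the orientable surface with $h$ handles is $2h$, and of the non-orientable surface with $c$ cross-caps is $c$. In an embedded graph, two distinct vertices $v,w$ are visible ($v$ sees $w$) if they appear on a common face, i.e. both lie on the facial walk of some face.
   Formalization: The parameter ε ranges only over rational numbers in the interval $(0,2)$. -}

module Defs where

open import Data.Nat using (ℕ; zero; suc; _+_; _*_; _<ᵇ_; _≤_)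
open import Data.Bool using (Bool; true; false; if_then_else_; _∧_; T)
open import Data.Fin using (Fin; toℕ)
import Data.Fin as Fin
open import Data.Product using (Σ; ∃; _×_; _,_)
open import Data.Sum using (_⊎_)
open import Data.Integer using (ℤ)
import Data.Integer as ℤ
open import Data.Rational using (ℚ; _/_)
open import Relation.Binary.PropositionalEquality using (_≡_; _≢_)
open import Relation.Nullary using (¬_)
open import Function using (_∘_)

record Graph (n : ℕ) : Set where
  field
    adj      : Fin n → Fin n → Bool
    symmetric : ∀ u v → adj u v ≡ adj v u
    irreflexive : ∀ v → adj v v ≡ false
open Graph public

count : ∀ {n} → (Fin n → Bool) → ℕ
count {zero}  f = 0
count {suc n} f = (if f Fin.zero then 1 else 0) + count (f ∘ Fin.suc)

sumFin : ∀ {n} → (Fin n → ℕ) → ℕ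
sumFin {zero}  f = 0
sumFin {suc n} f = f Fin.zero + sumFin (f ∘ Fin.suc)

degree : ∀ {n} → Graph n → Fin n → ℕ
degree G v = count (adj G v)

edgeCount : ∀ {n} → Graph n → ℕ
edgeCount G = sumFin (λ i → count (λ j → adj G i j ∧ (toℕ i <ᵇ toℕ j)))

minDegree≥ : ∀ {n} → Graph n → ℕ → Set
minDegree≥ G d = ∀ v → d ≤ degree G v

minDegree≡ : ∀ {n} → Graph n → ℕ → Set
minDegree≡ G d = minDegree≥ G d × ∃ λ v → degree G v ≡ d

-- average degree 2|E|/|V| as a rational (0 for the empty graph)
averageDegree : ∀ {n} → Graph n → ℚ
averageDegree {zero}  G = Data.Rational.0ℚ
averageDegree {suc n} G = ℤ.+ (2 * edgeCount G) / suc n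

data Walk {n} (G : Graph n) : Fin n → Fin n → Set where
  here : ∀ {v} → Walk G v v
  step : ∀ {u v w} → T (adj G u v) → Walk G v w → Walk G u w

Connected : ∀ {n} → Graph n → Set
Connected G = ∀ u v → Walk G u v

-- 2-cell embeddings, encoded combinatorially as graph-encoded maps
-- (gems / generalized maps): a finite set of flags with three
-- fixed-point-free involutions α₀ α₁ α₂ such that α₀α₂ = α₂α₀ is
-- also fixed-point-free.  Vertices, edges and faces of the embedded
-- graph are the orbits of ⟨α₁,α₂⟩, ⟨α₀,α₂⟩ and ⟨α₀,α₁⟩ respectively.
-- This encodes 2-cell embeddings of connected graphs in arbitrary
-- (orientable or non-orientable) closed surfaces.

data Conn {m} (p q : Fin m → Fin m) : Fin m → Fin m → Set where
  here  : ∀ {x} → Conn p q x x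
  viaP  : ∀ {x y} → Conn p q (p x) y → Conn p q x y
  viaQ  : ∀ {x y} → Conn p q (q x) y → Conn p q x y

IsFPFInvolution : ∀ {m} → (Fin m → Fin m) → Set
IsFPFInvolution f = (∀ x → f (f x) ≡ x) × (∀ x → f x ≢ x)

record Embedding {n : ℕ} (G : Graph n) (g : ℕ) : Set where
  field
    flags : ℕ
    α₀ α₁ α₂ : Fin flags → Fin flags
    α₀-inv : IsFPFInvolution α₀
    α₁-inv : IsFPFInvolution α₁
    α₂-inv : IsFPFInvolution α₂
    α₀α₂-comm : ∀ x → α₀ (α₂ x) ≡ α₂ (α₀ x)
    α₀α₂-fpf  : ∀ x → α₀ (α₂ x) ≢ x
    vert : Fin flags → Fin n
    vert-α₁ : ∀ x → vert (α₁ x) ≡ vert x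
    vert-α₂ : ∀ x → vert (α₂ x) ≡ vert x
    vert-orbit : ∀ x y → vert x ≡ vert y → Conn α₁ α₂ x y
    vert-onto : ∀ v → ∃ λ x → vert x ≡ v
    -- edges: the ⟨α₀,α₂⟩-orbits correspond bijectively to edges of G
    edge-adj : ∀ x → T (adj G (vert x) (vert (α₀ x)))
    edge-orbit : ∀ x y →
      ((vert x ≡ vert y × vert (α₀ x) ≡ vert (α₀ y)) ⊎
       (vert x ≡ vert (α₀ y) × vert (α₀ x) ≡ vert y)) →
      Conn α₀ α₂ x y
    edge-onto : ∀ u v → T (adj G u v) →
      ∃ λ x → vert x ≡ u × vert (α₀ x) ≡ v
    faces : ℕ
    face : Fin flags → Fin faces
    face-α₀ : ∀ x → face (α₀ x) ≡ face x
    face-α₁ : ∀ x → face (α₁ x) ≡ face x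
    face-orbit : ∀ x y → face x ≡ face y → Conn α₀ α₁ x y
    face-onto : ∀ f → ∃ λ x → face x ≡ f
    -- Euler's formula defines the Euler genus g of the surface:
    -- |V| - |E| + |F| = 2 - g
    euler : n + faces + g ≡ 2 + edgeCount G
open Embedding public

Sees : ∀ {n} {G : Graph n} {g} → Embedding G g → Fin n → Fin n → Set
Sees E v w = v ≢ w × ∃ λ x → ∃ λ y →
  vert E x ≡ v × vert E y ≡ w × face E x ≡ face E y

SeesAtMost : ∀ {n} {G : Graph n} {g} → Embedding G g → Fin n → ℕ → Set
SeesAtMost {n} E v k = ∀ (m : ℕ) (ws : Fin m → Fin n) →
  (∀ i j → ws i ≡ ws j → i ≡ j) → (∀ i → Sees E v (ws i)) → m ≤ k

module Submission where

-- Proof by discharging.  Put t = ⌈12/ε⌉ and suppose every vertex sees at least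
-- 3 + t vertices.  Let the size of a face be the number of distinct vertices on
-- its boundary (at least 3).  A face of size m gives each of its vertices
-- 3 + t - min(m - 3, t), so it sends out at least 3 (3 + t) in total.  A vertex v
-- sees at most deg v + Σ_{φ ∋ v} (|φ| - 3) vertices and lies on at most deg v
-- faces, so it receives at most (4 + t) deg v - (3 + t).  Summing gives
-- 3 (3 + t) |F| + (3 + t) |V| ≤ (4 + t) 2|E|, which together with Euler's formula
-- and the density hypotheses (for ε = p/q, inequalities between naturals) is
-- arithmetically impossible.

module Visibility where

  open import Defs
  open import Data.Nat using (ℕ; zero; suc; _+_; _*_; _∸_; _⊓_; _≤_; _<_; _<ᵇ_; _≤?_; z≤n; s≤s)
  open import Data.Nat.Properties hiding (_≟_; suc-injective)
  open import Data.Bool using (Bool; true; false; if_then_else_; _∧_; not; T)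
  open import Data.Bool.Properties using (T-∧)
  open import Function.Bundles using (Equivalence)
  open import Data.Fin using (Fin; toℕ) renaming (zero to fzero; suc to fsuc)
  open import Data.Fin.Properties using (_≟_; suc-injective; any?; toℕ-injective)
  open import Data.List using (List; []; _∷_; length)
  open import Data.List.Membership.Propositional using (_∈_)
  open import Data.List.Relation.Unary.Any using (here; there)
  open import Data.Empty using (⊥; ⊥-elim)
  open import Data.Unit using (tt)
  open import Data.Product using (∃; _×_; _,_; proj₁; proj₂)
  open import Data.Sum using (_⊎_; inj₁; inj₂)
  open import Function using (_∘_; case_of_)
  open import Relation.Binary.PropositionalEquality
  open import Relation.Binary.Definitions using (tri<; tri≈; tri>)
  open import Relation.Nullary using (¬_; Dec; yes; no; does)
  open import Relation.Nullary.Decidable using (⌊_⌋; _×-dec_; ¬?; T?; fromWitness; toWitness)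
  open import Algebra.Properties.Semiring.Sum +-*-semiring
    using (sum; sum-cong-≗; ∑-distrib-+; ∑-comm; *-distribˡ-sum; *-distribʳ-sum)
  open import Data.Nat.Tactic.RingSolver using (solve-∀)
  open import Algebra.Properties.CommutativeSemigroup +-commutativeSemigroup
    using (x∙yz≈y∙xz)

  ∑-mono-≤ : ∀ {n} {f h : Fin n → ℕ} → (∀ i → f i ≤ h i) → sum f ≤ sum h
  ∑-mono-≤ {zero}  f≤h = z≤n
  ∑-mono-≤ {suc n} f≤h = +-mono-≤ (f≤h fzero) (∑-mono-≤ (f≤h ∘ fsuc))

  ∑-const : ∀ n (c : ℕ) → sum {n} (λ _ → c) ≡ n * c
  ∑-const zero    c = refl
  ∑-const (suc n) c = cong (c +_) (∑-const n c)

  term≤∑ : ∀ {n} (f : Fin n → ℕ) i → f i ≤ sum f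
  term≤∑ f fzero    = m≤m+n _ _
  term≤∑ f (fsuc i) = ≤-trans (term≤∑ (f ∘ fsuc) i) (m≤n+m _ _)

  ⊓-subadditive : ∀ a b t → (a + b) ⊓ t ≤ a ⊓ t + b ⊓ t
  ⊓-subadditive a b t with ≤-total a t
  ... | inj₁ a≤t = begin
    (a + b) ⊓ t        ≤⟨ ⊓-monoʳ-≤ (a + b) (m≤m+n t a) ⟩
    (a + b) ⊓ (t + a)  ≡⟨ cong ((a + b) ⊓_) (+-comm t a) ⟩
    (a + b) ⊓ (a + t)  ≡⟨ sym (+-distribˡ-⊓ a b t) ⟩
    a + b ⊓ t          ≡⟨ cong (_+ b ⊓ t) (sym (m≤n⇒m⊓n≡m a≤t)) ⟩
    a ⊓ t + b ⊓ t      ∎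
    where open ≤-Reasoning
  ... | inj₂ t≤a = begin
    (a + b) ⊓ t  ≤⟨ m⊓n≤n (a + b) t ⟩
    t            ≡⟨ sym (m≥n⇒m⊓n≡n t≤a) ⟩
    a ⊓ t        ≤⟨ m≤m+n (a ⊓ t) (b ⊓ t) ⟩
    a ⊓ t + b ⊓ t ∎
    where open ≤-Reasoning

  ∑-⊓ : ∀ {n} (f : Fin n → ℕ) t → sum f ⊓ t ≤ sum (λ i → f i ⊓ t)
  ∑-⊓ {zero}  f t = z≤n
  ∑-⊓ {suc n} f t = ≤-trans (⊓-subadditive (f fzero) (sum (f ∘ fsuc)) t)
                            (+-monoʳ-≤ (f fzero ⊓ t) (∑-⊓ (f ∘ fsuc) t))

  indicator : Bool → ℕ
  indicator b = if b then 1 else 0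

  count≡∑ : ∀ {n} (P : Fin n → Bool) → count P ≡ sum (indicator ∘ P)
  count≡∑ {zero}  P = refl
  count≡∑ {suc n} P = cong (indicator (P fzero) +_) (count≡∑ (P ∘ fsuc))

  sumFin≡∑ : ∀ {n} (f : Fin n → ℕ) → sumFin f ≡ sum f
  sumFin≡∑ {zero}  f = refl
  sumFin≡∑ {suc n} f = cong (f fzero +_) (sumFin≡∑ (f ∘ fsuc))

  indicator-mono : ∀ {b c} → (T b → T c) → indicator b ≤ indicator c
  indicator-mono {false}         _   = z≤n
  indicator-mono {true}  {true}  _   = ≤-refl
  indicator-mono {true}  {false} b⇒c = ⊥-elim (b⇒c tt)

  indicator≤1 : ∀ b → indicator b ≤ 1
  indicator≤1 true  = ≤-refl
  indicator≤1 false = z≤n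

  indicator-true : ∀ {b} → T b → indicator b ≡ 1
  indicator-true {true} _ = refl

  indicator-bound : ∀ b c {k} → (T b → c ≤ k) → indicator b * c ≤ k
  indicator-bound false c _   = z≤n
  indicator-bound true  c c≤k = ≤-trans (≤-reflexive (+-identityʳ c)) (c≤k tt)

  indicator-false : ∀ {b} → ¬ T b → indicator b ≡ 0
  indicator-false {false} _  = refl
  indicator-false {true}  ¬b = ⊥-elim (¬b tt)

  T-not : ∀ {b} → ¬ T b → T (not b)
  T-not {false} _  = tt
  T-not {true}  ¬b = ¬b tt

  T-not-elim : ∀ {b} → T (not b) → ¬ T b
  T-not-elim {false} _ ()

  count-mono : ∀ {n} {P Q : Fin n → Bool} → (∀ i → T (P i) → T (Q i)) → count P ≤ count Q
  count-mono {zero}  P⊆Q = z≤n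
  count-mono {suc n} P⊆Q = +-mono-≤ (indicator-mono (P⊆Q fzero)) (count-mono (P⊆Q ∘ fsuc))

  count-none : ∀ {n} (P : Fin n → Bool) → (∀ i → ¬ T (P i)) → count P ≡ 0
  count-none {n} P none = n≤0⇒n≡0 (≤-trans (count-mono {Q = λ _ → false} (λ i → ⊥-elim ∘ none i))
                                               (≤-reflexive (count-false n)))
    where
    count-false : ∀ n → count {n} (λ _ → false) ≡ 0
    count-false zero    = refl
    count-false (suc n) = count-false n

  count-guarded : ∀ {n} b (P : Fin n → Bool) {c} → (T b → count P ≤ c) →
    count (λ i → b ∧ P i) ≤ indicator b * c
  count-guarded {n} false P _    = ≤-reflexive (count-none {n} (λ _ → false) (λ _ ()))
  count-guarded true  P {c} bound = ≤-trans (bound tt) (≤-reflexive (sym (*-identityˡ c)))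

  _∖_ : ∀ {n} → (Fin n → Bool) → Fin n → (Fin n → Bool)
  (P ∖ a) i = not (does (i ≟ a)) ∧ P i

  ∖-intro : ∀ {n} {P : Fin n → Bool} {a i} → T (P i) → i ≢ a → T ((P ∖ a) i)
  ∖-intro {a = a} {i} Pi i≢a with i ≟ a
  ... | yes i≡a = i≢a i≡a
  ... | no  _   = Pi

  ∖-elim : ∀ {n} {P : Fin n → Bool} {a i} → T ((P ∖ a) i) → T (P i) × i ≢ a
  ∖-elim {a = a} {i} h with i ≟ a
  ... | no i≢a = h , i≢a

  count-split : ∀ {n} (P : Fin n → Bool) a → count P ≡ indicator (P a) + count (P ∖ a)
  count-split P fzero    = refl
  count-split P (fsuc a) = begin
    indicator (P fzero) + count (P ∘ fsuc)
      ≡⟨ cong (indicator (P fzero) +_) (count-split (P ∘ fsuc) a) ⟩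
    indicator (P fzero) + (indicator (P (fsuc a)) + count ((P ∘ fsuc) ∖ a))
      ≡⟨ x∙yz≈y∙xz (indicator (P fzero)) (indicator (P (fsuc a))) (count ((P ∘ fsuc) ∖ a)) ⟩
    indicator (P (fsuc a)) + (indicator (P fzero) + count ((P ∘ fsuc) ∖ a)) ∎
    where open ≡-Reasoning

  count-remove : ∀ {n} {P : Fin n → Bool} {a} → T (P a) → count P ≡ suc (count (P ∖ a))
  count-remove {P = P} {a} Pa with P a | count-split P a
  ... | true | split = split

  count-⊆-list : ∀ {n} (P : Fin n → Bool) (xs : List (Fin n)) →
    (∀ i → T (P i) → i ∈ xs) → count P ≤ length xs
  count-⊆-list P []       P⊆xs = ≤-reflexive (count-none P (λ i Pi → case P⊆xs i Pi of λ ()))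
  count-⊆-list P (x ∷ xs) P⊆xs = begin
    count P                         ≡⟨ count-split P x ⟩
    indicator (P x) + count (P ∖ x) ≤⟨ +-mono-≤ (indicator≤1 (P x)) (count-⊆-list (P ∖ x) xs P∖x⊆xs) ⟩
    suc (length xs)                 ∎
    where
    open ≤-Reasoning
    P∖x⊆xs : ∀ i → T ((P ∖ x) i) → i ∈ xs
    P∖x⊆xs i h with ∖-elim {P = P} h
    ... | Pi , i≢x with P⊆xs i Pi
    ...   | here i≡x   = ⊥-elim (i≢x i≡x)
    ...   | there i∈xs = i∈xs

  count-injection : ∀ {n m} (P : Fin n → Bool) (ws : Fin m → Fin n) →
    (∀ i j → ws i ≡ ws j → i ≡ j) → (∀ i → T (P (ws i))) → m ≤ count P
  count-injection {m = zero}  P ws inj inP = z≤n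
  count-injection {m = suc m} P ws inj inP = begin
    suc m                      ≤⟨ s≤s (count-injection (P ∖ ws fzero) (ws ∘ fsuc) (λ i j → suc-injective ∘ inj (fsuc i) (fsuc j)) rest) ⟩
    suc (count (P ∖ ws fzero)) ≡⟨ sym (count-remove {P = P} (inP fzero)) ⟩
    count P                    ∎
    where
    open ≤-Reasoning
    rest : ∀ i → T ((P ∖ ws fzero) (ws (fsuc i)))
    rest i = ∖-intro {P = P} (inP (fsuc i)) (λ e → case inj (fsuc i) fzero e of λ ())

  -- The handshake lemma: each edge is counted once from each of its ends, while
  -- edgeCount counts it once, from its end with the smaller index.
  module _ {n} (G : Graph n) where

    private
      forward : Fin n → Fin n → ℕ
      forward v w = indicator (adj G v w ∧ (toℕ v <ᵇ toℕ w))

      one-direction : ∀ {m k} → m ≢ k → indicator (m <ᵇ k) + indicator (k <ᵇ m) ≡ 1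
      one-direction {m} {k} m≢k with <-cmp m k
      ... | tri< m<k _ _ = cong₂ _+_ (indicator-true (<⇒<ᵇ m<k)) (indicator-false (<-asym m<k ∘ <ᵇ⇒< k m))
      ... | tri≈ _ m≡k _ = ⊥-elim (m≢k m≡k)
      ... | tri> _ _ k<m = cong₂ _+_ (indicator-false (<-asym k<m ∘ <ᵇ⇒< m k)) (indicator-true (<⇒<ᵇ k<m))

      adjacency-split : ∀ v w → indicator (adj G v w) ≡ forward v w + forward w v
      adjacency-split v w rewrite symmetric G w v with adj G v w in vw
      ... | false = refl
      ... | true  = sym (one-direction λ v≡w →
        case trans (sym vw) (trans (cong (adj G v) (sym (toℕ-injective v≡w))) (irreflexive G v)) of λ ())

    handshake : sum (degree G) ≡ 2 * edgeCount G
    handshake = begin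
      sum (degree G)                                       ≡⟨ sum-cong-≗ (λ v → count≡∑ (adj G v)) ⟩
      sum (λ v → sum (λ w → indicator (adj G v w)))        ≡⟨ sum-cong-≗ (λ v → sum-cong-≗ (adjacency-split v)) ⟩
      sum (λ v → sum (λ w → forward v w + forward w v))    ≡⟨ sum-cong-≗ (λ v → ∑-distrib-+ (forward v) (λ w → forward w v)) ⟩
      sum (λ v → S v + sum (λ w → forward w v))            ≡⟨ ∑-distrib-+ S (λ v → sum (λ w → forward w v)) ⟩
      sum S + sum (λ v → sum (λ w → forward w v))          ≡⟨ cong (sum S +_) (sym (∑-comm forward)) ⟩
      sum S + sum S                                        ≡⟨ cong (sum S +_) (sym (+-identityʳ (sum S))) ⟩
      2 * sum S                                            ≡⟨ cong (2 *_) (sym edges) ⟩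
      2 * edgeCount G                                      ∎
      where
      open ≡-Reasoning
      S : Fin n → ℕ
      S v = sum (forward v)
      edges : edgeCount G ≡ sum S
      edges = trans (sumFin≡∑ (λ v → count (λ w → adj G v w ∧ (toℕ v <ᵇ toℕ w)))) (sum-cong-≗ (λ v → count≡∑ (λ w → adj G v w ∧ (toℕ v <ᵇ toℕ w))))

  module _ {n} {G : Graph n} {g} (E : Embedding G g) where

    private
      α₀α₀ : ∀ x → α₀ E (α₀ E x) ≡ x
      α₀α₀ = proj₁ (α₀-inv E)
      α₁α₁ : ∀ x → α₁ E (α₁ E x) ≡ x
      α₁α₁ = proj₁ (α₁-inv E)
      α₂α₂ : ∀ x → α₂ E (α₂ E x) ≡ x
      α₂α₂ = proj₁ (α₂-inv E)

    edge-orbit-elements : ∀ {x y} → Conn (α₀ E) (α₂ E) x y →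
      y ≡ x ⊎ y ≡ α₀ E x ⊎ y ≡ α₂ E x ⊎ y ≡ α₀ E (α₂ E x)
    edge-orbit-elements here = inj₁ refl
    edge-orbit-elements {x} (viaP c) with edge-orbit-elements c
    ... | inj₁ y≡α₀x                  = inj₂ (inj₁ y≡α₀x)
    ... | inj₂ (inj₁ y≡α₀α₀x)         = inj₁ (trans y≡α₀α₀x (α₀α₀ x))
    ... | inj₂ (inj₂ (inj₁ y≡α₂α₀x))  = inj₂ (inj₂ (inj₂ (trans y≡α₂α₀x (sym (α₀α₂-comm E x)))))
    ... | inj₂ (inj₂ (inj₂ y≡α₀α₂α₀x)) =
      inj₂ (inj₂ (inj₁ (trans y≡α₀α₂α₀x (trans (cong (α₀ E) (sym (α₀α₂-comm E x))) (α₀α₀ (α₂ E x))))))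
    edge-orbit-elements {x} (viaQ c) with edge-orbit-elements c
    ... | inj₁ y≡α₂x                  = inj₂ (inj₂ (inj₁ y≡α₂x))
    ... | inj₂ (inj₁ y≡α₀α₂x)         = inj₂ (inj₂ (inj₂ y≡α₀α₂x))
    ... | inj₂ (inj₂ (inj₁ y≡α₂α₂x))  = inj₁ (trans y≡α₂α₂x (α₂α₂ x))
    ... | inj₂ (inj₂ (inj₂ y≡α₀α₂α₂x)) = inj₂ (inj₁ (trans y≡α₀α₂α₂x (cong (α₀ E) (α₂α₂ x))))

    no-loop : ∀ x → vert E x ≢ vert E (α₀ E x)
    no-loop x v≡w = subst T (trans (cong (adj G (vert E x)) (sym v≡w)) (irreflexive G (vert E x))) (edge-adj E x)

    same-corner-edge : ∀ x y → vert E x ≡ vert E y → vert E (α₀ E x) ≡ vert E (α₀ E y) →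
      y ≡ x ⊎ y ≡ α₂ E x
    same-corner-edge x y ends₀ ends₁ with edge-orbit-elements (edge-orbit E x y (inj₁ (ends₀ , ends₁)))
    ... | inj₁ y≡x                   = inj₁ y≡x
    ... | inj₂ (inj₂ (inj₁ y≡α₂x))   = inj₂ y≡α₂x
    ... | inj₂ (inj₁ y≡α₀x)          = ⊥-elim (no-loop x (trans ends₀ (cong (vert E) y≡α₀x)))
    ... | inj₂ (inj₂ (inj₂ y≡α₀α₂x)) = ⊥-elim (no-loop x (begin
      vert E x                   ≡⟨ ends₀ ⟩
      vert E y                   ≡⟨ cong (vert E) y≡α₀α₂x ⟩
      vert E (α₀ E (α₂ E x))     ≡⟨ cong (vert E) (α₀α₂-comm E x) ⟩
      vert E (α₂ E (α₀ E x))     ≡⟨ vert-α₂ E (α₀ E x) ⟩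
      vert E (α₀ E x)            ∎))
      where open ≡-Reasoning

    small-vertex-orbit : ∀ x → α₁ E x ≡ α₂ E x → ∀ {y z} → y ≡ x ⊎ y ≡ α₁ E x →
      Conn (α₁ E) (α₂ E) y z → z ≡ x ⊎ z ≡ α₁ E x
    small-vertex-orbit x α₁x≡α₂x y∈ here = y∈
    small-vertex-orbit x α₁x≡α₂x (inj₁ refl) (viaP c) = small-vertex-orbit x α₁x≡α₂x (inj₂ refl) c
    small-vertex-orbit x α₁x≡α₂x (inj₂ refl) (viaP c) = small-vertex-orbit x α₁x≡α₂x (inj₁ (α₁α₁ x)) c
    small-vertex-orbit x α₁x≡α₂x (inj₁ refl) (viaQ c) = small-vertex-orbit x α₁x≡α₂x (inj₂ (sym α₁x≡α₂x)) c
    small-vertex-orbit x α₁x≡α₂x (inj₂ refl) (viaQ c) =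
      small-vertex-orbit x α₁x≡α₂x (inj₁ (trans (cong (α₂ E) α₁x≡α₂x) (α₂α₂ x))) c

    -- At a vertex of degree at least 2, the two edges bounding a corner lead to
    -- distinct neighbours (otherwise the vertex orbit would be {x, α₁x}).
    corner-neighbours-distinct : ∀ x → 2 ≤ degree G (vert E x) →
      vert E (α₀ E x) ≢ vert E (α₀ E (α₁ E x))
    corner-neighbours-distinct x deg≥2 same with same-corner-edge x (α₁ E x) (sym (vert-α₁ E x)) same
    ... | inj₁ α₁x≡x    = proj₂ (α₁-inv E) x α₁x≡x
    ... | inj₂ α₁x≡α₂x = <-irrefl refl (≤-trans deg≥2 (count-⊆-list (adj G (vert E x)) (vert E (α₀ E x) ∷ []) only-neighbour))
      where
      only-neighbour : ∀ u → T (adj G (vert E x) u) → u ∈ vert E (α₀ E x) ∷ []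
      only-neighbour u adj-u with edge-onto E (vert E x) u adj-u
      ... | z , z-at-x , z-to-u with small-vertex-orbit x α₁x≡α₂x (inj₁ refl) (vert-orbit E x z (sym z-at-x))
      ...   | inj₁ refl = here (sym z-to-u)
      ...   | inj₂ refl = here (trans (sym z-to-u) (sym same))

    Incident : Fin n → Fin (faces E) → Set
    Incident v φ = ∃ λ x → vert E x ≡ v × face E x ≡ φ

    incident? : ∀ v φ → Dec (Incident v φ)
    incident? v φ = any? (λ x → (vert E x ≟ v) ×-dec (face E x ≟ φ))

    onFace : Fin (faces E) → Fin n → Bool
    onFace φ v = ⌊ incident? v φ ⌋

    faceSize : Fin (faces E) → ℕ
    faceSize φ = count (onFace φ)

    -- Around the corner of the face of x at vert x, the boundary walk passes from
    -- neighbour₁ x through vert x to neighbour₀ x.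
    neighbour₀ neighbour₁ : Fin (flags E) → Fin n
    neighbour₀ x = vert E (α₀ E x)
    neighbour₁ x = vert E (α₀ E (α₁ E x))

    adj-neighbour₀ : ∀ x → T (adj G (vert E x) (neighbour₀ x))
    adj-neighbour₀ = edge-adj E

    adj-neighbour₁ : ∀ x → T (adj G (vert E x) (neighbour₁ x))
    adj-neighbour₁ x = subst (λ v → T (adj G v (neighbour₁ x))) (vert-α₁ E x) (edge-adj E (α₁ E x))

    on-face : ∀ x → T (onFace (face E x) (vert E x))
    on-face x = fromWitness (x , refl , refl)

    neighbour₀-on-face : ∀ x → T (onFace (face E x) (neighbour₀ x))
    neighbour₀-on-face x = fromWitness (α₀ E x , refl , face-α₀ E x)

    neighbour₁-on-face : ∀ x → T (onFace (face E x) (neighbour₁ x))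
    neighbour₁-on-face x = fromWitness (α₀ E (α₁ E x) , refl , trans (face-α₀ E (α₁ E x)) (face-α₁ E x))

    face-size-split : ∀ x → 2 ≤ degree G (vert E x) →
      let P = onFace (face E x) in
      faceSize (face E x) ≡ 3 + count (((P ∖ vert E x) ∖ neighbour₀ x) ∖ neighbour₁ x)
    face-size-split x deg≥2 = begin
      count P                                    ≡⟨ count-remove {P = P} (on-face x) ⟩
      suc (count (P ∖ v))                        ≡⟨ cong suc (count-remove {P = P ∖ v} a∈P∖v) ⟩
      suc (suc (count ((P ∖ v) ∖ a)))            ≡⟨ cong (suc ∘ suc) (count-remove {P = (P ∖ v) ∖ a} b∈P∖v∖a) ⟩
      3 + count (((P ∖ v) ∖ a) ∖ b)              ∎
      where
      open ≡-Reasoning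
      P = onFace (face E x)
      v = vert E x
      a = neighbour₀ x
      b = neighbour₁ x
      a∈P∖v : T ((P ∖ v) a)
      a∈P∖v = ∖-intro {P = P} (neighbour₀-on-face x) (≢-sym (no-loop x))
      b∈P∖v∖a : T (((P ∖ v) ∖ a) b)
      b∈P∖v∖a = ∖-intro {P = P ∖ v}
        (∖-intro {P = P} (neighbour₁-on-face x) (λ b≡v → no-loop (α₁ E x) (trans (vert-α₁ E x) (sym b≡v))))
        (≢-sym (corner-neighbours-distinct x deg≥2))

    face-size≥3 : minDegree≥ G 2 → ∀ φ → 3 ≤ faceSize φ
    face-size≥3 δ≥2 φ with face-onto E φ
    ... | x , refl = ≤-trans (m≤m+n 3 _) (≤-reflexive (sym (face-size-split x (δ≥2 (vert E x)))))

    farOn : Fin n → Fin (faces E) → Fin n → Bool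
    farOn v φ w = not (adj G v w) ∧ onFace φ w

    -- The vertices of φ other than v and its neighbours, provided v is on φ;
    -- these are the vertices v sees through φ without an edge.
    hidden : Fin n → Fin (faces E) → Fin n → Bool
    hidden v φ w = onFace φ v ∧ (farOn v φ ∖ v) w

    hidden-count : minDegree≥ G 2 → ∀ v φ → count (hidden v φ) ≤ indicator (onFace φ v) * (faceSize φ ∸ 3)
    hidden-count δ≥2 v φ = count-guarded (onFace φ v) (farOn v φ ∖ v) at-corner
      where
      at-corner : T (onFace φ v) → count (farOn v φ ∖ v) ≤ faceSize φ ∸ 3
      at-corner v∈φ with toWitness {a? = incident? v φ} v∈φ
      ... | x , refl , refl = begin
        count (farOn v φ ∖ v)                     ≤⟨ count-mono hidden⊆ ⟩
        count rest                                ≡⟨ sym (m+n∸m≡n 3 (count rest)) ⟩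
        3 + count rest ∸ 3                        ≡⟨ cong (_∸ 3) (sym (face-size-split x (δ≥2 v))) ⟩
        faceSize φ ∸ 3                            ∎
        where
        open ≤-Reasoning
        P    = onFace (face E x)
        rest = ((P ∖ vert E x) ∖ neighbour₀ x) ∖ neighbour₁ x
        hidden⊆ : ∀ w → T ((farOn v φ ∖ v) w) → T (rest w)
        hidden⊆ w h with ∖-elim {P = farOn v φ} h
        ... | h′ , w≢v with Equivalence.to T-∧ h′
        ...   | ¬adj , w∈P = ∖-intro {P = (P ∖ v) ∖ neighbour₀ x} {neighbour₁ x} {w}
          (∖-intro {P = P ∖ v} {neighbour₀ x} {w} (∖-intro {P = P} {v} {w} w∈P w≢v)
            (λ { refl → T-not-elim ¬adj (adj-neighbour₀ x) }))
          (λ { refl → T-not-elim ¬adj (adj-neighbour₁ x) })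

    facesAt : Fin n → ℕ
    facesAt v = count (λ φ → onFace φ v)

    Consecutive : Fin n → Fin n → Fin (faces E) → Set
    Consecutive v u φ = ∃ λ z → vert E z ≡ v × vert E (α₀ E z) ≡ u × face E z ≡ φ

    consecutive? : ∀ v u φ → Dec (Consecutive v u φ)
    consecutive? v u φ = any? (λ z → (vert E z ≟ v) ×-dec ((vert E (α₀ E z) ≟ u) ×-dec (face E z ≟ φ)))

    consecutive : Fin n → Fin n → Fin (faces E) → Bool
    consecutive v u φ = ⌊ consecutive? v u φ ⌋

    two-consecutive : minDegree≥ G 2 → ∀ v φ → indicator (onFace φ v) * 2 ≤ count (λ u → consecutive v u φ)
    two-consecutive δ≥2 v φ = indicator-bound (onFace φ v) 2 at-corner
      where
      at-corner : T (onFace φ v) → 2 ≤ count (λ u → consecutive v u φ)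
      at-corner v∈φ with toWitness {a? = incident? v φ} v∈φ
      ... | x , refl , refl = begin
        2                                                       ≤⟨ s≤s (s≤s z≤n) ⟩
        suc (suc (count ((C ∖ neighbour₀ x) ∖ neighbour₁ x)))  ≡⟨ cong suc (sym (count-remove {P = C ∖ neighbour₀ x} b∈C∖a)) ⟩
        suc (count (C ∖ neighbour₀ x))                          ≡⟨ sym (count-remove {P = C} a∈C) ⟩
        count C                                                 ∎
        where
        open ≤-Reasoning
        C = λ u → consecutive (vert E x) u (face E x)
        a∈C : T (C (neighbour₀ x))
        a∈C = fromWitness (x , refl , refl , refl)
        b∈C∖a : T ((C ∖ neighbour₀ x) (neighbour₁ x))
        b∈C∖a = ∖-intro {P = C} {neighbour₀ x} {neighbour₁ x}
          (fromWitness (α₁ E x , vert-α₁ E x , refl , face-α₁ E x))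
          (≢-sym (corner-neighbours-distinct x (δ≥2 (vert E x))))

    -- An edge vu is traversed from v to u by at most two face boundaries
    -- (the faces on its two sides); a non-edge by none.
    consecutive-faces : ∀ v u → count (λ φ → consecutive v u φ) ≤ indicator (adj G v u) * 2
    consecutive-faces v u with T? (adj G v u)
    ... | no ¬vu = ≤-trans (≤-reflexive (count-none _ (λ φ c → ¬vu (consecutive⇒adj φ c)))) z≤n
      where
      consecutive⇒adj : ∀ φ → T (consecutive v u φ) → T (adj G v u)
      consecutive⇒adj φ c with toWitness {a? = consecutive? v u φ} c
      ... | z , refl , refl , _ = edge-adj E z
    ... | yes vu with edge-onto E v u vu
    ...   | y , y-at-v , y-to-u rewrite indicator-true vu =
      count-⊆-list _ (face E y ∷ face E (α₂ E y) ∷ []) two-sides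
      where
      two-sides : ∀ φ → T (consecutive v u φ) → φ ∈ face E y ∷ face E (α₂ E y) ∷ []
      two-sides φ c with toWitness {a? = consecutive? v u φ} c
      ... | z , z-at-v , z-to-u , refl with same-corner-edge y z (trans y-at-v (sym z-at-v)) (trans y-to-u (sym z-to-u))
      ...   | inj₁ refl = here refl
      ...   | inj₂ refl = there (here refl)

    -- Double counting pairs (face at v, vertex following v on it).
    facesAt≤degree : minDegree≥ G 2 → ∀ v → facesAt v ≤ degree G v
    facesAt≤degree δ≥2 v = *-cancelʳ-≤ (facesAt v) (degree G v) 2 (begin
      facesAt v * 2                                         ≡⟨ cong (_* 2) (count≡∑ (λ φ → onFace φ v)) ⟩
      sum (λ φ → indicator (onFace φ v)) * 2                ≡⟨ *-distribʳ-sum 2 (λ φ → indicator (onFace φ v)) ⟩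
      sum (λ φ → indicator (onFace φ v) * 2)                ≤⟨ ∑-mono-≤ (two-consecutive δ≥2 v) ⟩
      sum (λ φ → count (λ u → consecutive v u φ))           ≡⟨ sum-cong-≗ (λ φ → count≡∑ (λ u → consecutive v u φ)) ⟩
      sum (λ φ → sum (λ u → indicator (consecutive v u φ))) ≡⟨ ∑-comm (λ φ u → indicator (consecutive v u φ)) ⟩
      sum (λ u → sum (λ φ → indicator (consecutive v u φ))) ≡⟨ sum-cong-≗ (λ u → sym (count≡∑ (λ φ → consecutive v u φ))) ⟩
      sum (λ u → count (λ φ → consecutive v u φ))           ≤⟨ ∑-mono-≤ (consecutive-faces v) ⟩
      sum (λ u → indicator (adj G v u) * 2)                 ≡⟨ sym (*-distribʳ-sum 2 (indicator ∘ adj G v)) ⟩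
      sum (indicator ∘ adj G v) * 2                         ≡⟨ cong (_* 2) (sym (count≡∑ (adj G v))) ⟩
      degree G v * 2                                        ∎)
      where open ≤-Reasoning

    sees? : ∀ v w → Dec (Sees E v w)
    sees? v w = ¬? (v ≟ w) ×-dec any? (λ x → any? (λ y →
      (vert E x ≟ v) ×-dec ((vert E y ≟ w) ×-dec (face E x ≟ face E y))))

    visible : Fin n → Fin n → Bool
    visible v w = ⌊ sees? v w ⌋

    visibility : Fin n → ℕ
    visibility v = count (visible v)

    sees-at-most-visibility : ∀ v → SeesAtMost E v (visibility v)
    sees-at-most-visibility v m ws inj sees = count-injection (visible v) ws inj (λ i → fromWitness (sees i))

    visible-split : ∀ v w → T (visible v w) → T (adj G v w) ⊎ ∃ λ φ → T (hidden v φ w)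
    visible-split v w vis with T? (adj G v w) | toWitness {a? = sees? v w} vis
    ... | yes vw  | _ = inj₁ vw
    ... | no ¬vw | v≢w , x , y , refl , refl , same-face = inj₂ (face E x ,
      Equivalence.from T-∧ (on-face x , ∖-intro {P = farOn v (face E x)} {v} {w}
        (Equivalence.from T-∧ (T-not ¬vw , fromWitness (y , refl , sym same-face))) (≢-sym v≢w)))

    excess : Fin n → ℕ
    excess v = sum (λ φ → indicator (onFace φ v) * (faceSize φ ∸ 3))

    -- v sees its neighbours and, on each incident face φ, at most faceSize φ - 3 others.
    visibility≤degree+excess : minDegree≥ G 2 → ∀ v → visibility v ≤ degree G v + excess v
    visibility≤degree+excess δ≥2 v = begin
      visibility v                                                ≡⟨ count≡∑ (visible v) ⟩
      sum (indicator ∘ visible v)                                 ≤⟨ ∑-mono-≤ seen-by-edge-or-face ⟩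
      sum (λ w → indicator (adj G v w) + sum (λ φ → H φ w))       ≡⟨ ∑-distrib-+ (indicator ∘ adj G v) (λ w → sum (λ φ → H φ w)) ⟩
      sum (indicator ∘ adj G v) + sum (λ w → sum (λ φ → H φ w))   ≡⟨ cong₂ _+_ (sym (count≡∑ (adj G v))) (∑-comm (λ w φ → H φ w)) ⟩
      degree G v + sum (λ φ → sum (λ w → H φ w))                  ≡⟨ cong (degree G v +_) (sum-cong-≗ (λ φ → sym (count≡∑ (hidden v φ)))) ⟩
      degree G v + sum (λ φ → count (hidden v φ))                 ≤⟨ +-monoʳ-≤ (degree G v) (∑-mono-≤ (hidden-count δ≥2 v)) ⟩
      degree G v + excess v                                       ∎
      where
      open ≤-Reasoning
      H : Fin (faces E) → Fin n → ℕ
      H φ w = indicator (hidden v φ w)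
      seen-by-edge-or-face : ∀ w → indicator (visible v w) ≤ indicator (adj G v w) + sum (λ φ → H φ w)
      seen-by-edge-or-face w = ≤-trans (≤-reflexive (sym (*-identityʳ _))) (indicator-bound (visible v w) 1 λ vis →
        case visible-split v w vis of λ where
          (inj₁ vw) → ≤-trans (≤-reflexive (sym (indicator-true vw))) (m≤m+n _ _)
          (inj₂ (φ , h)) → ≤-trans (≤-trans (≤-reflexive (sym (indicator-true h))) (term≤∑ (λ φ → H φ w) φ)) (m≤n+m _ _))

  -- Fix t; the visibility threshold is 3 + t.  A face of size m
  -- sends share t m to each of its vertices: 3 + t, reduced by its excess m - 3
  -- over a triangle, but never below 3.  The reduction is capped t m.
  capped : ℕ → ℕ → ℕ
  capped t m = (m ∸ 3) ⊓ t

  share : ℕ → ℕ → ℕ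
  share t m = 3 + (t ∸ capped t m)

  share+capped : ∀ t m → share t m + capped t m ≡ 3 + t
  share+capped t m = cong (3 +_) (m∸n+n≡m (m⊓n≤n (m ∸ 3) t))

  -- With m = 3 + s: if t ≤ s it
  -- sends 3 to each of its 3 + s ≥ 3 + t vertices; otherwise, writing t = s + r,
  -- it sends 3 + r to each of 3 + s vertices, and (3 + s)(3 + r) = 3 (3 + t) + s r.
  face-charge : ∀ t m → 3 ≤ m → 3 * (3 + t) ≤ m * share t m
  face-charge t (suc (suc (suc s))) _ with ≤-total s t
  ... | inj₂ t≤s rewrite m≥n⇒m⊓n≡n t≤s | n∸n≡0 t =
    ≤-trans (*-monoʳ-≤ 3 (+-monoʳ-≤ 3 t≤s)) (≤-reflexive (*-comm 3 (3 + s)))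
  ... | inj₁ s≤t with m≤n⇒∃[o]m+o≡n s≤t
  ...   | r , refl rewrite m≤n⇒m⊓n≡m s≤t | m+n∸m≡n s r =
    ≤-trans (m≤m+n (3 * (3 + (s + r))) (s * r)) (≤-reflexive (expand s r))
    where
    expand : ∀ s r → 3 * (3 + (s + r)) + s * r ≡ (3 + s) * (3 + r)
    expand = solve-∀
  face-charge t 0 ()
  face-charge t 1 (s≤s ())
  face-charge t 2 (s≤s (s≤s ()))

  module _ {n} {G : Graph n} {g} (E : Embedding G g) (t : ℕ) where

    charge : Fin n → ℕ
    charge v = sum (λ φ → indicator (onFace E φ v) * share t (faceSize E φ))

    private
      cappedExcess : Fin n → Fin (faces E) → ℕ
      cappedExcess v φ = (indicator (onFace E φ v) * (faceSize E φ ∸ 3)) ⊓ t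

      per-face : ∀ b m → indicator b * share t m + (indicator b * (m ∸ 3)) ⊓ t ≡ indicator b * (3 + t)
      per-face false m = refl
      per-face true  m = begin
        1 * share t m + (1 * (m ∸ 3)) ⊓ t  ≡⟨ cong₂ (λ a b → a + b ⊓ t) (*-identityˡ (share t m)) (*-identityˡ (m ∸ 3)) ⟩
        share t m + capped t m             ≡⟨ share+capped t m ⟩
        3 + t                              ≡⟨ *-identityˡ (3 + t) ⟨
        1 * (3 + t)                        ∎
        where open ≡-Reasoning

    charge+capped : ∀ v → charge v + sum (cappedExcess v) ≡ (3 + t) * facesAt E v
    charge+capped v = begin
      charge v + sum (cappedExcess v)                      ≡⟨ ∑-distrib-+ (λ φ → indicator (onFace E φ v) * share t (faceSize E φ)) (cappedExcess v) ⟨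
      sum (λ φ → indicator (onFace E φ v) * share t (faceSize E φ) + cappedExcess v φ)
                                                           ≡⟨ sum-cong-≗ (λ φ → per-face (onFace E φ v) (faceSize E φ)) ⟩
      sum (λ φ → indicator (onFace E φ v) * (3 + t))       ≡⟨ *-distribʳ-sum (3 + t) (λ φ → indicator (onFace E φ v)) ⟨
      sum (λ φ → indicator (onFace E φ v)) * (3 + t)       ≡⟨ cong (_* (3 + t)) (sym (count≡∑ (λ φ → onFace E φ v))) ⟩
      facesAt E v * (3 + t)                                ≡⟨ *-comm (facesAt E v) (3 + t) ⟩
      (3 + t) * facesAt E v                                ∎
      where open ≡-Reasoning

    vertex-charge : minDegree≥ G 3 → ∀ v → 3 + t ≤ visibility E v → charge v + (3 + t) ≤ (4 + t) * degree G v
    vertex-charge δ≥3 v sees-many = begin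
      charge v + (3 + t)                 ≤⟨ +-monoʳ-≤ (charge v) threshold ⟩
      charge v + (d + sum (cappedExcess v)) ≡⟨ x∙yz≈y∙xz (charge v) d (sum (cappedExcess v)) ⟩
      d + (charge v + sum (cappedExcess v)) ≡⟨ cong (d +_) (charge+capped v) ⟩
      d + (3 + t) * facesAt E v          ≤⟨ +-monoʳ-≤ d (*-monoʳ-≤ (3 + t) (facesAt≤degree E δ≥2 v)) ⟩
      d + (3 + t) * d                    ∎
      where
      open ≤-Reasoning
      d = degree G v
      δ≥2 : minDegree≥ G 2
      δ≥2 u = ≤-trans (n≤1+n 2) (δ≥3 u)
      -- 3 + t ≤ d + excess (visibility) and 3 + t ≤ d + t (degree), so the capped excess suffices.
      threshold : 3 + t ≤ d + sum (cappedExcess v)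
      threshold = begin
        3 + t                                ≤⟨ ⊓-glb (≤-trans sees-many (visibility≤degree+excess E δ≥2 v)) (+-monoˡ-≤ t (δ≥3 v)) ⟩
        (d + excess E v) ⊓ (d + t)          ≡⟨ +-distribˡ-⊓ d (excess E v) t ⟨
        d + excess E v ⊓ t                  ≤⟨ +-monoʳ-≤ d (∑-⊓ (λ φ → indicator (onFace E φ v) * (faceSize E φ ∸ 3)) t) ⟩
        d + sum (cappedExcess v)            ∎

    discharging : minDegree≥ G 3 → (∀ v → 3 + t ≤ visibility E v) →
      faces E * (3 * (3 + t)) + n * (3 + t) ≤ (4 + t) * (2 * edgeCount G)
    discharging δ≥3 sees-many = begin
      faces E * (3 * (3 + t)) + n * (3 + t)                        ≡⟨ cong₂ _+_ (∑-const (faces E) (3 * (3 + t))) (∑-const n (3 + t)) ⟨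
      sum {faces E} (λ φ → 3 * (3 + t)) + sum {n} (λ v → 3 + t)    ≤⟨ +-monoˡ-≤ (sum {n} (λ v → 3 + t)) (∑-mono-≤ (λ φ → face-charge t (faceSize E φ) (face-size≥3 E δ≥2 φ))) ⟩
      sum (λ φ → faceSize E φ * share t (faceSize E φ)) + sum {n} (λ v → 3 + t)
                                                                   ≡⟨ cong (_+ sum {n} (λ v → 3 + t)) charges-collected ⟩
      sum charge + sum {n} (λ v → 3 + t)                            ≡⟨ ∑-distrib-+ charge (λ v → 3 + t) ⟨
      sum (λ v → charge v + (3 + t))                               ≤⟨ ∑-mono-≤ (λ v → vertex-charge δ≥3 v (sees-many v)) ⟩
      sum (λ v → (4 + t) * degree G v)                             ≡⟨ *-distribˡ-sum (4 + t) (degree G) ⟨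
      (4 + t) * sum (degree G)                                     ≡⟨ cong ((4 + t) *_) (handshake G) ⟩
      (4 + t) * (2 * edgeCount G)                                  ∎
      where
      open ≤-Reasoning
      δ≥2 : minDegree≥ G 2
      δ≥2 u = ≤-trans (n≤1+n 2) (δ≥3 u)
      charges-collected : sum (λ φ → faceSize E φ * share t (faceSize E φ)) ≡ sum charge
      charges-collected = begin-equality
        sum (λ φ → faceSize E φ * share t (faceSize E φ))                    ≡⟨ sum-cong-≗ (λ φ → cong (_* share t (faceSize E φ)) (count≡∑ (onFace E φ))) ⟩
        sum (λ φ → sum (indicator ∘ onFace E φ) * share t (faceSize E φ))    ≡⟨ sum-cong-≗ (λ φ → *-distribʳ-sum (share t (faceSize E φ)) (indicator ∘ onFace E φ)) ⟩
        sum (λ φ → sum (λ v → indicator (onFace E φ v) * share t (faceSize E φ))) ≡⟨ ∑-comm (λ φ v → indicator (onFace E φ v) * share t (faceSize E φ)) ⟩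
        sum charge                                                           ∎

  -- Euler's formula n + f + g = 2 + e removes the faces from the discharging inequality.
  euler-discharging : ∀ c n e f g → n + f + g ≡ 2 + e →
    f * (3 * (3 + c)) + n * (3 + c) ≤ (4 + c) * (2 * e) →
    3 * (3 + c) * (2 + e) + n * (3 + c) ≤ 3 * (3 + c) * n + 3 * (3 + c) * g + (4 + c) * (2 * e)
  euler-discharging c n e f g euler charges = begin
    3 * (3 + c) * (2 + e) + n * (3 + c)                            ≡⟨ cong (λ k → 3 * (3 + c) * k + n * (3 + c)) euler ⟨
    3 * (3 + c) * (n + f + g) + n * (3 + c)                        ≡⟨ regroup c n f g ⟩
    3 * (3 + c) * n + 3 * (3 + c) * g + (f * (3 * (3 + c)) + n * (3 + c)) ≤⟨ +-monoʳ-≤ (3 * (3 + c) * n + 3 * (3 + c) * g) charges ⟩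
    3 * (3 + c) * n + 3 * (3 + c) * g + (4 + c) * (2 * e)          ∎
    where
    open ≤-Reasoning
    regroup : ∀ c n f g → 3 * (3 + c) * (n + f + g) + n * (3 + c) ≡
      3 * (3 + c) * n + 3 * (3 + c) * g + (f * (3 * (3 + c)) + n * (3 + c))
    regroup = solve-∀

  -- The final inequality, with ε = p/q: the density hypotheses
  -- (4 + ε) n ≤ 2e, (24/ε + 6) g ≤ n and 12/ε ≤ c contradict the above.
  -- Certificate: 24q·(Euler-discharging) + 12(c+1)·(density) + 3(3+c)·(genus)
  -- + 8n·(threshold) leaves a surplus of (3 + c)(144q + pn + 18pg) > 0.
  dense-arithmetic : ∀ c n e g p q → 0 < q →
    3 * (3 + c) * (2 + e) + n * (3 + c) ≤ 3 * (3 + c) * n + 3 * (3 + c) * g + (4 + c) * (2 * e) →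
    (4 * q + p) * n ≤ 2 * e * q →
    (24 * q + 6 * p) * g ≤ p * n →
    12 * q ≤ c * p →
    ⊥
  dense-arithmetic c n e g p q@(suc _) _ charges density genus threshold =
    <-irrefl refl (<-≤-trans (m<m+n R (s≤s z≤n)) (≤-trans (≤-reflexive (sym (certificate c n e g p q))) combined))
    where
    L R : ℕ
    L = 24 * q * (3 * (3 + c) * (2 + e) + n * (3 + c)) + 12 * (c + 1) * ((4 * q + p) * n)
        + 3 * (3 + c) * ((24 * q + 6 * p) * g) + 8 * n * (12 * q)
    R = 24 * q * (3 * (3 + c) * n + 3 * (3 + c) * g + (4 + c) * (2 * e)) + 12 * (c + 1) * (2 * e * q)
        + 3 * (3 + c) * (p * n) + 8 * n * (c * p)
    combined : L ≤ R
    combined = +-mono-≤ (+-mono-≤ (+-mono-≤ (*-monoʳ-≤ (24 * q) charges) (*-monoʳ-≤ (12 * (c + 1)) density))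
                                  (*-monoʳ-≤ (3 * (3 + c)) genus)) (*-monoʳ-≤ (8 * n) threshold)
    certificate : ∀ c n e g p q →
      24 * q * (3 * (3 + c) * (2 + e) + n * (3 + c)) + 12 * (c + 1) * ((4 * q + p) * n)
        + 3 * (3 + c) * ((24 * q + 6 * p) * g) + 8 * n * (12 * q)
      ≡ 24 * q * (3 * (3 + c) * n + 3 * (3 + c) * g + (4 + c) * (2 * e)) + 12 * (c + 1) * (2 * e * q)
        + 3 * (3 + c) * (p * n) + 8 * n * (c * p) + (3 + c) * (144 * q + p * n + 18 * p * g)
    certificate = solve-∀

  few-visible-vertex : ∀ {n} {G : Graph n} {g} (E : Embedding G g) → minDegree≥ G 3 →
    ∀ c p q → 0 < q →
    (4 * q + p) * n ≤ 2 * edgeCount G * q →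
    (24 * q + 6 * p) * g ≤ p * n →
    12 * q ≤ c * p →
    ∃ λ v → visibility E v ≤ 2 + c
  few-visible-vertex {n} {G} {g} E δ≥3 c p q 0<q density genus threshold
    with any? (λ v → visibility E v ≤? 2 + c)
  ... | yes few = few
  ... | no ¬few = ⊥-elim (dense-arithmetic c n (edgeCount G) g p q 0<q
    (euler-discharging c n (edgeCount G) (faces E) g (euler E)
      (discharging E c δ≥3 (λ v → ≰⇒> (λ few → ¬few (v , few)))))
    density genus threshold)

module Fractions where

  open import Data.Nat using (ℕ; suc; _+_; _*_; _≤_; NonZero)
  open import Data.Nat.Properties using (*-identityʳ; *-identityˡ; *-comm)
  open import Data.Nat.Coprimality using (Coprime)
  open import Data.Integer using (ℤ; +_; +[1+_]; -[1+_])
  import Data.Integer as ℤ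
  import Data.Integer.Properties as ℤP
  open import Data.Integer.DivMod using ([n/d]*d≤n)
  open import Data.Rational as ℚ using (ℚ; mkℚ; ↥_; ↧_; ceiling; floor; toℚᵘ)
  import Data.Rational.Properties as ℚP
  open import Data.Rational.Unnormalised using (mkℚᵘ; *≤*; *≡*)
    renaming (_/_ to _/ᵘ_; _+_ to _+ᵘ_; _*_ to _*ᵘ_; _≤_ to _≤ᵘ_; _≃_ to _≃ᵘ_)
  import Data.Rational.Unnormalised.Properties as ℚᵘP
  open import Data.Product using (∃; _×_; _,_)
  open import Relation.Binary.PropositionalEquality
  open import Data.Nat.Tactic.RingSolver using (solve-∀)

  toℚᵘ-ℕ/ : ∀ a m .{{_ : NonZero m}} → toℚᵘ (+ a ℚ./ m) ≃ᵘ + a /ᵘ m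
  toℚᵘ-ℕ/ a (suc m) = ℚP.toℚᵘ-fromℚᵘ (+ a /ᵘ suc m)

  ℕ/-≤ : ∀ a b m m' .{{_ : NonZero m}} .{{_ : NonZero m'}} → + a /ᵘ m ≤ᵘ + b /ᵘ m' → a * m' ≤ b * m
  ℕ/-≤ a b (suc m) (suc m') (*≤* h) = ℤP.drop‿+≤+ (subst₂ ℤ._≤_ (sym (ℤP.pos-* a (suc m'))) (sym (ℤP.pos-* b (suc m))) h)

  ℕ/-≃ : ∀ a b m m' .{{_ : NonZero m}} .{{_ : NonZero m'}} → a * m' ≡ b * m → + a /ᵘ m ≃ᵘ + b /ᵘ m'
  ℕ/-≃ a b (suc m) (suc m') e = *≡* (trans (sym (ℤP.pos-* a (suc m'))) (trans (cong +_ e) (ℤP.pos-* b (suc m))))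

  ℕ/-+ : ∀ a b m m' → + a /ᵘ suc m +ᵘ + b /ᵘ suc m' ≡ + (a * suc m' + b * suc m) /ᵘ (suc m * suc m')
  ℕ/-+ a b m m' = cong (λ i → mkℚᵘ i _)
    (sym (trans (ℤP.pos-+ (a * suc m') (b * suc m)) (cong₂ ℤ._+_ (ℤP.pos-* a (suc m')) (ℤP.pos-* b (suc m)))))

  ℕ/-* : ∀ a b m m' → (+ a /ᵘ suc m) *ᵘ (+ b /ᵘ suc m') ≡ + (a * b) /ᵘ (suc m * suc m')
  ℕ/-* a b m m' = cong (λ i → mkℚᵘ i _) (sym (ℤP.pos-* a b))

  floor-≤ : ∀ s → floor s ℤ.* ↧ s ℤ.≤ ↥ s
  floor-≤ s@(mkℚ _ _ _) = [n/d]*d≤n (↥ s) (↧ s)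

  ≤-ceiling : ∀ r → toℚᵘ r ≤ᵘ mkℚᵘ (ceiling r) 0
  ≤-ceiling r@(mkℚ _ _ _) = *≤* (begin
    ↥ r ℤ.* + 1                        ≡⟨ ℤP.*-identityʳ (↥ r) ⟩
    ↥ r                                ≡⟨ ℤP.neg-involutive (↥ r) ⟨
    ℤ.- (ℤ.- ↥ r)                      ≡⟨ cong ℤ.-_ (ℚP.↥-neg r) ⟨
    ℤ.- ↥ (ℚ.- r)                        ≤⟨ ℤP.neg-mono-≤ (floor-≤ (ℚ.- r)) ⟩
    ℤ.- (floor (ℚ.- r) ℤ.* ↧ (ℚ.- r))      ≡⟨ ℤP.neg-distribˡ-* (floor (ℚ.- r)) (↧ (ℚ.- r)) ⟩
    ceiling r ℤ.* ↧ (ℚ.- r)              ≡⟨ cong (ceiling r ℤ.*_) (ℚP.↧-neg r) ⟩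
    ceiling r ℤ.* ↧ r                  ∎)
    where open ℤP.≤-Reasoning

  module PositiveRational (k d : ℕ) .(cop : Coprime (suc k) (suc d)) where

    ε : ℚ
    ε = mkℚ +[1+ k ] d cop

    private
      p q : ℕ
      p = suc k
      q = suc d

    a÷ε : ∀ a → toℚᵘ ((+ a ℚ./ 1) ℚ.÷ ε) ≃ᵘ + (a * q) /ᵘ p
    a÷ε a = begin
      toℚᵘ ((+ a ℚ./ 1) ℚ.* ℚ.1/ ε)      ≈⟨ ℚP.toℚᵘ-homo-* (+ a ℚ./ 1) (ℚ.1/ ε) ⟩
      toℚᵘ (+ a ℚ./ 1) *ᵘ (+ q /ᵘ p)     ≈⟨ ℚᵘP.*-congʳ (toℚᵘ-ℕ/ a 1) ⟩
      (+ a /ᵘ 1) *ᵘ (+ q /ᵘ p)           ≡⟨ ℕ/-* a q 0 k ⟩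
      + (a * q) /ᵘ (1 * p)               ≈⟨ ℕ/-≃ (a * q) (a * q) (1 * p) p (cong (a * q *_) (sym (*-identityˡ p))) ⟩
      + (a * q) /ᵘ p                     ∎
      where open ℚᵘP.≃-Reasoning

    density : ∀ e n → (+ 4 ℚ./ 1) ℚ.+ ε ℚ.≤ + (2 * e) ℚ./ suc n → (4 * q + p) * suc n ≤ 2 * e * q
    density e n h = ℕ/-≤ (4 * q + p) (2 * e) q (suc n) (begin
      + (4 * q + p) /ᵘ q             ≃⟨ four+ε ⟨
      toℚᵘ ((+ 4 ℚ./ 1) ℚ.+ ε)       ≤⟨ ℚP.toℚᵘ-mono-≤ h ⟩
      toℚᵘ (+ (2 * e) ℚ./ suc n)     ≃⟨ toℚᵘ-ℕ/ (2 * e) (suc n) ⟩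
      + (2 * e) /ᵘ suc n             ∎)
      where
      open ℚᵘP.≤-Reasoning
      four+ε : toℚᵘ ((+ 4 ℚ./ 1) ℚ.+ ε) ≃ᵘ + (4 * q + p) /ᵘ q
      four+ε = ℚᵘP.≃-trans (ℚP.toℚᵘ-homo-+ (+ 4 ℚ./ 1) ε)
        (ℚᵘP.≃-trans (ℚᵘP.≃-reflexive (ℕ/-+ 4 p 0 d)) (ℕ/-≃ _ _ (1 * q) q (normalise k d)))
        where
        normalise : ∀ k d → (4 * suc d + suc k * 1) * suc d ≡ (4 * suc d + suc k) * (1 * suc d)
        normalise = solve-∀

    genus : ∀ g n → ((+ 24 ℚ./ 1) ℚ.÷ ε ℚ.+ (+ 6 ℚ./ 1)) ℚ.* (+ g ℚ./ 1) ℚ.≤ + n ℚ./ 1 →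
      (24 * q + 6 * p) * g ≤ p * n
    genus g n h = subst₂ _≤_ (*-identityʳ _) (*-comm n p) (ℕ/-≤ ((24 * q + 6 * p) * g) n p 1 (begin
      + ((24 * q + 6 * p) * g) /ᵘ p                                  ≃⟨ lhs ⟨
      toℚᵘ (((+ 24 ℚ./ 1) ℚ.÷ ε ℚ.+ (+ 6 ℚ./ 1)) ℚ.* (+ g ℚ./ 1))  ≤⟨ ℚP.toℚᵘ-mono-≤ h ⟩
      toℚᵘ (+ n ℚ./ 1)                                               ≃⟨ toℚᵘ-ℕ/ n 1 ⟩
      + n /ᵘ 1                                                       ∎))
      where
      open ℚᵘP.≤-Reasoning
      lhs : toℚᵘ (((+ 24 ℚ./ 1) ℚ.÷ ε ℚ.+ (+ 6 ℚ./ 1)) ℚ.* (+ g ℚ./ 1)) ≃ᵘ + ((24 * q + 6 * p) * g) /ᵘ p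
      lhs = begin-equality
        toℚᵘ (((+ 24 ℚ./ 1) ℚ.÷ ε ℚ.+ (+ 6 ℚ./ 1)) ℚ.* (+ g ℚ./ 1))
          ≃⟨ ℚP.toℚᵘ-homo-* ((+ 24 ℚ./ 1) ℚ.÷ ε ℚ.+ (+ 6 ℚ./ 1)) (+ g ℚ./ 1) ⟩
        toℚᵘ ((+ 24 ℚ./ 1) ℚ.÷ ε ℚ.+ (+ 6 ℚ./ 1)) *ᵘ toℚᵘ (+ g ℚ./ 1)
          ≃⟨ ℚᵘP.*-cong (ℚᵘP.≃-trans (ℚP.toℚᵘ-homo-+ ((+ 24 ℚ./ 1) ℚ.÷ ε) (+ 6 ℚ./ 1)) (ℚᵘP.+-congˡ (toℚᵘ (+ 6 ℚ./ 1)) (a÷ε 24))) (toℚᵘ-ℕ/ g 1) ⟩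
        (+ (24 * q) /ᵘ p +ᵘ + 6 /ᵘ 1) *ᵘ (+ g /ᵘ 1)
          ≡⟨ cong (_*ᵘ (+ g /ᵘ 1)) (ℕ/-+ (24 * q) 6 k 0) ⟩
        (+ (24 * q * 1 + 6 * p) /ᵘ (p * 1)) *ᵘ (+ g /ᵘ 1)
          ≡⟨ ℕ/-* (24 * q * 1 + 6 * p) g (k * 1) 0 ⟩
        + ((24 * q * 1 + 6 * p) * g) /ᵘ (p * 1 * 1)
          ≃⟨ ℕ/-≃ _ _ (p * 1 * 1) p (normalise k d g) ⟩
        + ((24 * q + 6 * p) * g) /ᵘ p  ∎
        where
        normalise : ∀ k d g → (24 * suc d * 1 + 6 * suc k) * g * suc k ≡ (24 * suc d + 6 * suc k) * g * (suc k * 1 * 1)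
        normalise = solve-∀

    threshold : ∃ λ c → ceiling ((+ 12 ℚ./ 1) ℚ.÷ ε) ≡ + c × 12 * q ≤ c * p
    threshold = natural (ceiling r) (ℚᵘP.≤-respˡ-≃ (a÷ε 12) (≤-ceiling r))
      where
      r = (+ 12 ℚ./ 1) ℚ.÷ ε
      natural : ∀ z → + (12 * q) /ᵘ p ≤ᵘ mkℚᵘ z 0 → ∃ λ c → z ≡ + c × 12 * q ≤ c * p
      natural (+ c)    h = c , refl , subst (_≤ c * p) (*-identityʳ (12 * q)) (ℕ/-≤ (12 * q) c p 1 h)
      natural -[1+ _ ] (*≤* ())

open import Defs
open import Data.Nat using (ℕ; zero; suc)
open import Data.Fin using (Fin)
open import Data.Product using (∃; _×_; _,_)
open import Data.Integer using (ℤ; +_)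
import Data.Integer as ℤ
open import Data.Rational using (ℚ; _/_; _<_; _≤_; _+_; _*_; _÷_; 0ℚ; NonZero; ceiling)

open import Data.Nat using (z≤n; s≤s)
open import Data.Integer using (+≤+; +<+; -[1+_]; +[1+_])
open import Data.Rational using (mkℚ)
open import Data.Rational.Properties using (drop-*<*)
open import Relation.Binary.PropositionalEquality using (subst; sym)
open Visibility using (visibility; sees-at-most-visibility; few-visible-vertex)
open Fractions.PositiveRational using (density; genus; threshold)

lemma6p3 : (ε : ℚ) .{{_ : NonZero ε}} → 0ℚ < ε → ε < + 2 / 1 →
    ∀ {n} (G : Graph n) (g : ℕ) (E : Embedding G g) →
    Connected G → minDegree≡ G 3 →
    (+ 4 / 1) + ε ≤ averageDegree G →
    ((+ 24 / 1) ÷ ε + (+ 6 / 1)) * (+ g / 1) ≤ + n / 1 →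
    ∃ λ (v : Fin n) → ∃ λ (k : ℕ) →
      SeesAtMost E v k × (+ k) ℤ.≤ (+ 2) ℤ.+ ceiling ((+ 12 / 1) ÷ ε)
-- ε = p/q with p, q positive: the other numerators contradict 0 < ε
lemma6p3 (mkℚ (+ zero) _ _) 0<ε _ with drop-*<* 0<ε
... | +<+ ()
lemma6p3 (mkℚ -[1+ _ ] _ _) 0<ε _ with drop-*<* 0<ε
... | ()
-- a graph with a vertex of degree 3 is not empty
lemma6p3 (mkℚ +[1+ k ] d cop) _ _ {zero} G g E _ (_ , () , _) _ _
lemma6p3 (mkℚ +[1+ k ] d cop) _ _ {suc n} G g E _ (δ≥3 , _) avg-degree order
  = let c , ceiling≡c , 12q≤cp = threshold k d cop
        v , few = few-visible-vertex E δ≥3 c (suc k) (suc d) (s≤s z≤n)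
                    (density k d cop (edgeCount G) n avg-degree) (genus k d cop g (suc n) order) 12q≤cp
    in v , visibility E v , sees-at-most-visibility E v ,
       subst (λ z → + visibility E v ℤ.≤ + 2 ℤ.+ z) (sym ceiling≡c) (+≤+ few)
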